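{- Let $G$ be a finite loopless weighted multigraph with strictly positive edge weights and $Q=(q_{ij})=(I+L(G))^{ -1}$. Let $k\ne t$ be vertices, and suppose $G'$ is obtained from $G$ either by increasing the weight of some edge between $k$ and $t$, or by adding a new edge between $k$ and $t$ with positive weight; let $Q'=(q'_{ij})=(I+L(G'))^{ -1}$ and $\Delta q_{ij}=q'_{ij}-q_{ij}$. Then: (1) $q_{kt}$ increases, i.e. $q'_{kt}>q_{kt}$; (2) for any vertex $i$, if there exists a path in $G$ from $i$ to $k$ and every path in $G$ from $i$ to $t$ contains $k$, then $\Delta q_{it}>\Delta q_{ik}$; (3) for any vertices $i_1,i_2$, if each of $i_1$ and $i_2$ satisfies the hypothesis on $i$ in item (2), then $q_{i_1i_2}$ decreases, i.e. $q'_{i_1i_2}<q_{i_1i_2}$; (4) for any vertex $i$, if $q_{ik}=q_{it}$, then $q'_{ij}=q_{ij}$ for all $j=1,\ldots,n$.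
   Context: $G$ has vertex set $\{1,\ldots,n\}$; for $i\ne j$, $a_{ij}$ is the number of edges between $i$ and $j$ and $\varepsilon_{ij}^p>0$ is the weight of the $p$-th such edge. The Kirchhoff matrix $L=(\ell_{ij})$ of a weighted multigraph has $\ell_{ij}=-\sum_{p=1}^{a_{ij}}\varepsilon_{ij}^p$ for $j\ne i$ and $\ell_{ii}=-\sum_{j\ne i}\ell_{ij}$. For such multigraphs $I+L$ is invertible. A path is an alternating sequence of distinct vertices and edges starting and ending with vertices, each edge lying between two vertices incident to it. -}

module Defs where

open import Level using (Level; _⊔_) renaming (suc to lsuc)
open import Algebra.Bundles using (CommutativeRing)
open import Relation.Binary.Core using (Rel)
open import Relation.Binary.Structures using (IsStrictTotalOrder)
open import Relation.Binary.PropositionalEquality using (_≡_; _≢_)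
open import Relation.Nullary using (¬_)
open import Relation.Nullary.Decidable using (⌊_⌋)
open import Data.Bool using (Bool; if_then_else_; _∧_; _∨_)
open import Data.Nat using (ℕ)
open import Data.Fin using (Fin) renaming (_≟_ to _≟ᶠ_)
open import Data.List using (List; []; _∷_; foldr; map; length; lookup; allFin; _++_; [_]; _[_]∷=_)
open import Data.List.Relation.Unary.Unique.Propositional using (Unique)
open import Data.List.Membership.Propositional using (_∈_)
open import Data.Product using (Σ; _×_)
open import Data.Sum using (_⊎_)

-- Ordered fields (the standard library has no real numbers; we work over
-- an arbitrary ordered field, of which ℝ is an instance).

record OrderedField (c ℓ₁ ℓ₂ : Level) : Set (lsuc (c ⊔ ℓ₁ ⊔ ℓ₂)) where
  field
    commutativeRing : CommutativeRing c ℓ₁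
  open CommutativeRing commutativeRing public
  infix 4 _<_
  field
    _<_                : Rel Carrier ℓ₂
    isStrictTotalOrder : IsStrictTotalOrder _≈_ _<_
    0≉1                : ¬ (0# ≈ 1#)
    +-mono-<           : ∀ {x y} z → x < y → x + z < y + z
    *-pos              : ∀ {x y} → 0# < x → 0# < y → 0# < x * y
    inverse            : ∀ x → ¬ (x ≈ 0#) → Σ Carrier (λ y → x * y ≈ 1#)

module _ {c ℓ₁ ℓ₂ : Level} (F : OrderedField c ℓ₁ ℓ₂) where
  open OrderedField F

  record Edge (n : ℕ) : Set (c ⊔ ℓ₂) where
    constructor edge
    field
      end₁   : Fin n
      end₂   : Fin n
      weight : Carrier
      loopless : end₁ ≢ end₂
      positive : 0# < weight

  Multigraph : ℕ → Set (c ⊔ ℓ₂)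
  Multigraph n = List (Edge n)

  Joins : {n : ℕ} → Edge n → Fin n → Fin n → Set
  Joins e i j = (Edge.end₁ e ≡ i × Edge.end₂ e ≡ j) ⊎ (Edge.end₁ e ≡ j × Edge.end₂ e ≡ i)

  joins? : {n : ℕ} → Edge n → Fin n → Fin n → Bool
  joins? e i j = (⌊ Edge.end₁ e ≟ᶠ i ⌋ ∧ ⌊ Edge.end₂ e ≟ᶠ j ⌋)
               ∨ (⌊ Edge.end₁ e ≟ᶠ j ⌋ ∧ ⌊ Edge.end₂ e ≟ᶠ i ⌋)

  sumList : List Carrier → Carrier
  sumList = foldr _+_ 0#

  sumFin : {n : ℕ} → (Fin n → Carrier) → Carrier
  sumFin {n} f = sumList (map f (allFin n))

  weightBetween : {n : ℕ} → Multigraph n → Fin n → Fin n → Carrier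
  weightBetween G i j = sumList (map (λ e → if joins? e i j then Edge.weight e else 0#) G)

  Matrix : ℕ → Set c
  Matrix n = Fin n → Fin n → Carrier

  kirchhoff : {n : ℕ} → Multigraph n → Matrix n
  kirchhoff G i j =
    if ⌊ i ≟ᶠ j ⌋
    then - sumFin (λ j′ → if ⌊ i ≟ᶠ j′ ⌋ then 0# else - weightBetween G i j′)
    else - weightBetween G i j

  identity : {n : ℕ} → Matrix n
  identity i j = if ⌊ i ≟ᶠ j ⌋ then 1# else 0#

  _⊕_ : {n : ℕ} → Matrix n → Matrix n → Matrix n
  (A ⊕ B) i j = A i j + B i j

  _⊗_ : {n : ℕ} → Matrix n → Matrix n → Matrix n
  (A ⊗ B) i j = sumFin (λ l → A i l * B l j)

  IsInverseOf : {n : ℕ} → Matrix n → Matrix n → Set ℓ₁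
  IsInverseOf Q A = (∀ i j → (A ⊗ Q) i j ≈ identity i j) × (∀ i j → (Q ⊗ A) i j ≈ identity i j)

  IplusL : {n : ℕ} → Multigraph n → Matrix n
  IplusL G = identity ⊕ kirchhoff G

  data Walk {n : ℕ} (G : Multigraph n) : Fin n → Fin n → Set (c ⊔ ℓ₂) where
    here : ∀ {i} → Walk G i i
    step : ∀ {i j k} (p : Fin (length G)) → Joins (lookup G p) i j → Walk G j k → Walk G i k

  walkVertices : ∀ {n} {G : Multigraph n} {i j} → Walk G i j → List (Fin n)
  walkVertices {i = i} here = i ∷ []
  walkVertices {i = i} (step p _ w) = i ∷ walkVertices w

  walkEdges : ∀ {n} {G : Multigraph n} {i j} → Walk G i j → List (Fin (length G))
  walkEdges here = []
  walkEdges (step p _ w) = p ∷ walkEdges w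

  IsPath : ∀ {n} {G : Multigraph n} {i j} → Walk G i j → Set
  IsPath w = Unique (walkVertices w) × Unique (walkEdges w)

  record Path {n : ℕ} (G : Multigraph n) (i j : Fin n) : Set (c ⊔ ℓ₂) where
    constructor path
    field
      walk   : Walk G i j
      isPath : IsPath walk

  PathContains : ∀ {n} {G : Multigraph n} {i j} → Path G i j → Fin n → Set
  PathContains P v = v ∈ walkVertices (Path.walk P)

  Separated : {n : ℕ} → Multigraph n → Fin n → Fin n → Fin n → Set (c ⊔ ℓ₂)
  Separated G k t i = Path G i k × (∀ (P : Path G i t) → PathContains P k)

  Perturbation : {n : ℕ} → Fin n → Fin n → Multigraph n → Multigraph n → Set (c ⊔ ℓ₂)
  Perturbation {n} k t G G′ =
      Σ (Fin (length G)) (λ p → Σ (Edge n) (λ e′ →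
         Joins (lookup G p) k t
       × Edge.end₁ e′ ≡ Edge.end₁ (lookup G p)
       × Edge.end₂ e′ ≡ Edge.end₂ (lookup G p)
       × Edge.weight (lookup G p) < Edge.weight e′
       × G′ ≡ G [ p ]∷= e′))
    ⊎ Σ (Edge n) (λ e′ → Joins e′ k t × G′ ≡ G ++ [ e′ ])

module Submission where

-- Write A = I + L(G). Raising the weight of a k–t edge by δ > 0 adds the rank-one matrix
-- δ u uᵀ to A, where u = e_k − e_t, so Q = Q′ + δ (Q u)(uᵀ Q′) (Sherman–Morrison), that is
-- q_ij = q′_ij + δ (q_ik − q_it)(q′_kj − q′_tj). Comparing rows k and t of this identity shows
-- that uᵀQ′ is uᵀQ divided by 1 + δ (uᵀQ)u > 0, so all four items reduce to the signs of the
-- differences q_ik − q_it and q_kj − q_tj. These come from a discrete maximum principle: a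
-- column x of Q (or a row, A being symmetric) solves x_v + Σ_l w_vl (x_v − x_l) = [v = s], so
-- x ≥ 0, x > 0 on the component of s, and every v ≠ s with x_v > 0 has a neighbour with a
-- larger value. If x_t ≥ x_k, climbing from t along strictly increasing values reaches s
-- along a path that avoids k; hence x_k > x_t whenever every s–t path passes through k.

open import Defs
open import Level using (_⊔_)
open import Algebra.Bundles using (CommutativeRing)
open import Data.Bool using (true; false; T; if_then_else_; _∧_; _∨_)
import Data.Bool.Properties as Bool
open import Data.Empty using (⊥; ⊥-elim)
open import Data.Fin using (Fin; zero; suc; _≟_)
open import Data.Fin.Induction using (spo-noetherian)
open import Data.Fin.Properties using (any?; suc-injective)
open import Data.Integer as ℤ using (ℤ; +_; -[1+_])
import Data.Integer.Properties as ℤ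
open import Data.List using (List; []; _∷_; map; lookup; allFin; _++_; [_]; _[_]∷=_)
import Data.List.Properties as List
open import Data.List.Relation.Unary.All as All using (All; []; _∷_)
open import Data.List.Relation.Unary.AllPairs using ([]; _∷_)
open import Data.List.Relation.Unary.Any using (here; there)
open import Data.List.Membership.Propositional using (_∈_)
open import Data.List.Membership.Propositional.Properties using (∈-allFin)
open import Data.Maybe using (Maybe; just; nothing)
open import Data.Nat as ℕ using (ℕ; zero; suc)
import Data.Nat.Properties as ℕ
open import Data.Product using (∃; _×_; _,_; proj₁; proj₂)
open import Data.Sign as Sign using (Sign)
open import Data.Sum using (_⊎_; inj₁; inj₂)
open import Function using (_∘_; flip; _on_)
open import Function.Bundles using (Equivalence)
open import Induction.WellFounded using (WellFounded; Acc; acc)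
open import Relation.Binary.Bundles using (StrictTotalOrder)
import Relation.Binary.Construct.On as On
import Relation.Binary.Construct.StrictToNonStrict as StrictToNonStrict
open import Relation.Binary.Definitions using (tri<; tri≈; tri>)
open import Relation.Binary.PropositionalEquality as ≡ using (_≡_; _≢_)
open import Relation.Binary.Structures using (IsStrictTotalOrder)
open import Relation.Nullary using (¬_; yes; no)
open import Relation.Nullary.Decidable using (⌊_⌋; _×-dec_)
import Algebra.Solver.Ring
open import Algebra.Solver.Ring.AlmostCommutativeRing
  using (_-Raw-AlmostCommutative⟶_; fromCommutativeRing)

-- The ring solver of the standard library needs a coefficient ring mapping into the carrier;
-- with ℤ as coefficients it can cancel additive inverses in any commutative ring.
module IntegerRingSolver {c ℓ} (R : CommutativeRing c ℓ) where
  open CommutativeRing R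
  open import Algebra.Properties.Ring ring using (-‿involutive; -0#≈0#; -1*x≈-x; -‿+-comm)
  open import Algebra.Properties.Semiring.Mult.TCOptimised semiring renaming (_×_ to _×ᵤ_)
  open import Algebra.Properties.CommutativeSemigroup *-commutativeSemigroup using (interchange)
  open import Algebra.Properties.CommutativeSemigroup +-commutativeSemigroup
    using () renaming (interchange to +-interchange)
  open import Relation.Binary.Reasoning.Setoid setoid

  fromℕ : ℕ → Carrier
  fromℕ n = n ×ᵤ 1#

  fromℤ : ℤ → Carrier
  fromℤ (+ n)      = fromℕ n
  fromℤ -[1+ n ]   = - fromℕ (suc n)

  fromSign : Sign → Carrier
  fromSign Sign.+ = 1#
  fromSign Sign.- = - 1#

  private
    -‿homo : ∀ i → fromℤ (ℤ.- i) ≈ - fromℤ i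
    -‿homo (+ zero)  = sym -0#≈0#
    -‿homo (+ suc n) = refl
    -‿homo -[1+ n ]  = sym (-‿involutive _)

    fromℕ-suc : ∀ n → fromℕ (suc n) ≈ 1# + fromℕ n
    fromℕ-suc n = 1+× n 1#

    ⊖-homo : ∀ m n → fromℤ (m ℤ.⊖ n) ≈ fromℕ m - fromℕ n
    ⊖-homo zero    zero    = sym (-‿inverseʳ 0#)
    ⊖-homo zero    (suc n) = sym (+-identityˡ _)
    ⊖-homo (suc m) zero    = sym (trans (+-congˡ -0#≈0#) (+-identityʳ _))
    ⊖-homo (suc m) (suc n) = begin
      fromℤ (suc m ℤ.⊖ suc n)               ≡⟨ ≡.cong fromℤ (ℤ.[1+m]⊖[1+n]≡m⊖n m n) ⟩
      fromℤ (m ℤ.⊖ n)                       ≈⟨ ⊖-homo m n ⟩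
      fromℕ m - fromℕ n                     ≈⟨ +-identityˡ _ ⟨
      0# + (fromℕ m - fromℕ n)              ≈⟨ +-congʳ (-‿inverseʳ 1#) ⟨
      (1# - 1#) + (fromℕ m - fromℕ n)       ≈⟨ +-interchange 1# (- 1#) (fromℕ m) (- fromℕ n) ⟩
      (1# + fromℕ m) + (- 1# - fromℕ n)     ≈⟨ +-congˡ (-‿+-comm 1# (fromℕ n)) ⟩
      (1# + fromℕ m) - (1# + fromℕ n)       ≈⟨ +-cong (fromℕ-suc m) (-‿cong (fromℕ-suc n)) ⟨
      fromℕ (suc m) - fromℕ (suc n)         ∎

    +-homo : ∀ i j → fromℤ (i ℤ.+ j) ≈ fromℤ i + fromℤ j
    +-homo (+ m)    (+ n)    = ×-homo-+ 1# m n
    +-homo (+ m)    -[1+ n ] = ⊖-homo m (suc n)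
    +-homo -[1+ m ] (+ n)    = trans (⊖-homo n (suc m)) (+-comm _ _)
    +-homo -[1+ m ] -[1+ n ] = begin
      - fromℕ (suc (suc (m ℕ.+ n)))         ≡⟨ ≡.cong (λ k → - fromℕ (suc k)) (ℕ.+-suc m n) ⟨
      - fromℕ (suc m ℕ.+ suc n)             ≈⟨ -‿cong (×-homo-+ 1# (suc m) (suc n)) ⟩
      - (fromℕ (suc m) + fromℕ (suc n))     ≈⟨ -‿+-comm _ _ ⟨
      - fromℕ (suc m) - fromℕ (suc n)       ∎

    ◃-homo : ∀ s n → fromℤ (s ℤ.◃ n) ≈ fromSign s * fromℕ n
    ◃-homo s      zero    = sym (zeroʳ _)
    ◃-homo Sign.+ (suc n) = sym (*-identityˡ _)
    ◃-homo Sign.- (suc n) = sym (-1*x≈-x _)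

    sign-abs : ∀ i → fromℤ i ≈ fromSign (ℤ.sign i) * fromℕ ℤ.∣ i ∣
    sign-abs (+ n)    = sym (*-identityˡ _)
    sign-abs -[1+ n ] = sym (-1*x≈-x _)

    fromSign-* : ∀ s t → fromSign (s Sign.* t) ≈ fromSign s * fromSign t
    fromSign-* Sign.+ t      = sym (*-identityˡ _)
    fromSign-* Sign.- Sign.+ = sym (*-identityʳ _)
    fromSign-* Sign.- Sign.- = sym (trans (-1*x≈-x _) (-‿involutive _))

    *-homo : ∀ i j → fromℤ (i ℤ.* j) ≈ fromℤ i * fromℤ j
    *-homo i j = begin
      fromℤ (i ℤ.* j)
        ≈⟨ ◃-homo (ℤ.sign i Sign.* ℤ.sign j) (ℤ.∣ i ∣ ℕ.* ℤ.∣ j ∣) ⟩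
      fromSign (ℤ.sign i Sign.* ℤ.sign j) * fromℕ (ℤ.∣ i ∣ ℕ.* ℤ.∣ j ∣)
        ≈⟨ *-cong (fromSign-* (ℤ.sign i) (ℤ.sign j)) (×1-homo-* ℤ.∣ i ∣ ℤ.∣ j ∣) ⟩
      (fromSign (ℤ.sign i) * fromSign (ℤ.sign j)) * (fromℕ ℤ.∣ i ∣ * fromℕ ℤ.∣ j ∣)
        ≈⟨ interchange _ _ _ _ ⟩
      (fromSign (ℤ.sign i) * fromℕ ℤ.∣ i ∣) * (fromSign (ℤ.sign j) * fromℕ ℤ.∣ j ∣)
        ≈⟨ *-cong (sign-abs i) (sign-abs j) ⟨
      fromℤ i * fromℤ j
        ∎

    fromℤ-homomorphism : ℤ.+-*-rawRing -Raw-AlmostCommutative⟶ fromCommutativeRing R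
    fromℤ-homomorphism = record
      { ⟦_⟧ = fromℤ ; +-homo = +-homo ; *-homo = *-homo ; -‿homo = -‿homo
      ; 0-homo = refl ; 1-homo = refl }

    fromℤ-≟ : ∀ i j → Maybe (fromℤ i ≈ fromℤ j)
    fromℤ-≟ i j with i ℤ.≟ j
    ... | yes ≡.refl = just refl
    ... | no _       = nothing

  open Algebra.Solver.Ring ℤ.+-*-rawRing (fromCommutativeRing R) fromℤ-homomorphism fromℤ-≟ public

module OrderedFieldProperties {c ℓ₁ ℓ₂} (F : OrderedField c ℓ₁ ℓ₂) where
  open OrderedField F
  open IntegerRingSolver commutativeRing using (solve; _:=_; _:+_; _:-_; _:*_; :-_; con)
  private module O = IsStrictTotalOrder isStrictTotalOrder

  strictTotalOrder : StrictTotalOrder c ℓ₁ ℓ₂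
  strictTotalOrder = record { isStrictTotalOrder = isStrictTotalOrder }

  open StrictTotalOrder strictTotalOrder public using (strictPartialOrder; _<?_)

  module ≤-Reasoning where
    open import Relation.Binary.Reasoning.StrictPartialOrder strictPartialOrder public

  open StrictToNonStrict _≈_ _<_ public using (_≤_; <⇒≤)

  ≤-refl : ∀ {x} → x ≤ x
  ≤-refl = inj₂ refl

  ≤-trans : ∀ {x y z} → x ≤ y → y ≤ z → x ≤ z
  ≤-trans = StrictToNonStrict.trans _≈_ _<_ O.isEquivalence O.<-resp-≈ O.trans

  <-≤-trans : ∀ {x y z} → x < y → y ≤ z → x < z
  <-≤-trans = StrictToNonStrict.<-≤-trans _≈_ _<_ O.trans O.<-respʳ-≈

  ≤-<-trans : ∀ {x y z} → x ≤ y → y < z → x < z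
  ≤-<-trans = StrictToNonStrict.≤-<-trans _≈_ _<_ sym O.trans O.<-respˡ-≈

  <-irrefl : ∀ {x} → ¬ (x < x)
  <-irrefl = O.irrefl refl

  ≤⇒≯ : ∀ {x y} → x ≤ y → ¬ (y < x)
  ≤⇒≯ x≤y y<x = <-irrefl (≤-<-trans x≤y y<x)

  ≮⇒≥ : ∀ {x y} → ¬ (x < y) → y ≤ x
  ≮⇒≥ {x} {y} x≮y with O.compare x y
  ... | tri< x<y _ _ = ⊥-elim (x≮y x<y)
  ... | tri≈ _ x≈y _ = inj₂ (sym x≈y)
  ... | tri> _ _ y<x = inj₁ y<x

  ≰⇒> : ∀ {x y} → ¬ (x ≤ y) → y < x
  ≰⇒> {x} {y} x≰y with O.compare x y
  ... | tri< x<y _ _ = ⊥-elim (x≰y (inj₁ x<y))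
  ... | tri≈ _ x≈y _ = ⊥-elim (x≰y (inj₂ x≈y))
  ... | tri> _ _ y<x = y<x

  ≤-antisym : ∀ {x y} → x ≤ y → y ≤ x → x ≈ y
  ≤-antisym (inj₂ x≈y) _   = x≈y
  ≤-antisym (inj₁ x<y) y≤x = ⊥-elim (≤⇒≯ y≤x x<y)

  +-monoˡ-≤ : ∀ z {x y} → x ≤ y → x + z ≤ y + z
  +-monoˡ-≤ z (inj₁ x<y) = inj₁ (+-mono-< z x<y)
  +-monoˡ-≤ z (inj₂ x≈y) = inj₂ (+-congʳ x≈y)

  +-monoʳ-< : ∀ z {x y} → x < y → z + x < z + y
  +-monoʳ-< z {x} {y} x<y = O.<-respʳ-≈ (+-comm y z) (O.<-respˡ-≈ (+-comm x z) (+-mono-< z x<y))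

  +-monoʳ-≤ : ∀ z {x y} → x ≤ y → z + x ≤ z + y
  +-monoʳ-≤ z (inj₁ x<y) = inj₁ (+-monoʳ-< z x<y)
  +-monoʳ-≤ z (inj₂ x≈y) = inj₂ (+-congˡ x≈y)

  +-mono-≤ : ∀ {a b c d} → a ≤ b → c ≤ d → a + c ≤ b + d
  +-mono-≤ {b = b} {c} a≤b c≤d = ≤-trans (+-monoˡ-≤ c a≤b) (+-monoʳ-≤ b c≤d)

  +-mono-<-≤ : ∀ {a b c d} → a < b → c ≤ d → a + c < b + d
  +-mono-<-≤ {b = b} {c} a<b c≤d = <-≤-trans (+-mono-< c a<b) (+-monoʳ-≤ b c≤d)

  +-mono-≤-< : ∀ {a b c d} → a ≤ b → c < d → a + c < b + d
  +-mono-≤-< {b = b} {c} a≤b c<d = ≤-<-trans (+-monoˡ-≤ c a≤b) (+-monoʳ-< b c<d)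

  private
    [y-x]+x≈y : ∀ x y → (y - x) + x ≈ y
    [y-x]+x≈y = solve 2 (λ x y → (y :- x) :+ x := y) refl

    0-[x-y]≈y-x : ∀ x y → 0# - (x - y) ≈ y - x
    0-[x-y]≈y-x = solve 2 (λ x y → con (+ 0) :- (x :- y) := y :- x) refl

  x<y⇒0<y-x : ∀ {x y} → x < y → 0# < y - x
  x<y⇒0<y-x {x} x<y = O.<-respˡ-≈ (-‿inverseʳ x) (+-mono-< (- x) x<y)

  0<y-x⇒x<y : ∀ {x y} → 0# < y - x → x < y
  0<y-x⇒x<y {x} {y} 0<y-x = O.<-respʳ-≈ ([y-x]+x≈y x y) (O.<-respˡ-≈ (+-identityˡ x) (+-mono-< x 0<y-x))

  x≤y⇒0≤y-x : ∀ {x y} → x ≤ y → 0# ≤ y - x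
  x≤y⇒0≤y-x (inj₁ x<y) = inj₁ (x<y⇒0<y-x x<y)
  x≤y⇒0≤y-x {x} (inj₂ x≈y) = inj₂ (trans (sym (-‿inverseʳ x)) (+-congʳ x≈y))

  x<y⇒x-y<0 : ∀ {x y} → x < y → x - y < 0#
  x<y⇒x-y<0 {x} {y} x<y = 0<y-x⇒x<y (O.<-respʳ-≈ (sym (0-[x-y]≈y-x x y)) (x<y⇒0<y-x x<y))

  x≤y⇒x-y≤0 : ∀ {x y} → x ≤ y → x - y ≤ 0#
  x≤y⇒x-y≤0 (inj₁ x<y) = inj₁ (x<y⇒x-y<0 x<y)
  x≤y⇒x-y≤0 {x} (inj₂ x≈y) = inj₂ (trans (+-congˡ (-‿cong (sym x≈y))) (-‿inverseʳ x))

  x<0⇒0<-x : ∀ {x} → x < 0# → 0# < - x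
  x<0⇒0<-x {x} x<0 = O.<-respʳ-≈ (+-identityˡ (- x)) (x<y⇒0<y-x x<0)

  0<-x⇒x<0 : ∀ {x} → 0# < - x → x < 0#
  0<-x⇒x<0 {x} 0<-x = 0<y-x⇒x<y (O.<-respʳ-≈ (sym (+-identityˡ (- x))) 0<-x)

  0<1 : 0# < 1#
  0<1 with O.compare 0# 1#
  ... | tri< 0<1 _ _ = 0<1
  ... | tri≈ _ 0≈1 _ = ⊥-elim (0≉1 0≈1)
  ... | tri> _ _ 1<0 = ⊥-elim (<-irrefl (O.trans 1<0 (O.<-respʳ-≈ [-1]*[-1]≈1 (*-pos 0<-1 0<-1))))
    where
    0<-1 : 0# < - 1#
    0<-1 = x<0⇒0<-x 1<0
    [-1]*[-1]≈1 : - 1# * - 1# ≈ 1#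
    [-1]*[-1]≈1 = solve 0 (:- con (+ 1) :* :- con (+ 1) := con (+ 1)) refl

  *-nonneg : ∀ {a b} → 0# ≤ a → 0# ≤ b → 0# ≤ a * b
  *-nonneg (inj₁ 0<a) (inj₁ 0<b) = inj₁ (*-pos 0<a 0<b)
  *-nonneg {b = b} (inj₂ 0≈a) _  = inj₂ (trans (sym (zeroˡ b)) (*-congʳ 0≈a))
  *-nonneg {a} (inj₁ _) (inj₂ 0≈b) = inj₂ (trans (sym (zeroʳ a)) (*-congˡ 0≈b))

  *-pos-neg : ∀ {a b} → 0# < a → b < 0# → a * b < 0#
  *-pos-neg {a} {b} 0<a b<0 = 0<-x⇒x<0 (O.<-respʳ-≈ (sym (-‿distribʳ-* a b)) (*-pos 0<a (x<0⇒0<-x b<0)))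
    where open import Algebra.Properties.Ring ring using (-‿distribʳ-*)

  *-nonneg-nonpos : ∀ {a b} → 0# ≤ a → b ≤ 0# → a * b ≤ 0#
  *-nonneg-nonpos (inj₁ 0<a) (inj₁ b<0)    = inj₁ (*-pos-neg 0<a b<0)
  *-nonneg-nonpos {b = b} (inj₂ 0≈a) _     = inj₂ (trans (*-congʳ (sym 0≈a)) (zeroˡ b))
  *-nonneg-nonpos {a} (inj₁ _) (inj₂ b≈0)  = inj₂ (trans (*-congˡ b≈0) (zeroʳ a))

  pos-*-cancelʳ : ∀ {a p} → 0# < p → 0# < a * p → 0# < a
  pos-*-cancelʳ {a} {p} 0<p 0<ap = ≰⇒> λ a≤0 → ≤⇒≯ (≤-trans (inj₂ (*-comm a p)) (*-nonneg-nonpos (<⇒≤ 0<p) a≤0)) 0<ap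

module Summation {c ℓ₁ ℓ₂} (F : OrderedField c ℓ₁ ℓ₂) where
  open OrderedField F hiding (zero)
  open OrderedFieldProperties F
  open import Algebra.Properties.Semiring.Sum semiring public
    using (sum; sum-cong-≋; ∑-distrib-+; ∑-comm; *-distribˡ-sum; *-distribʳ-sum)
  open import Algebra.Properties.Ring ring using (-0#≈0#; -‿+-comm)

  sumFin≈sum : ∀ {n} (f : Fin n → Carrier) → sumFin F f ≈ sum f
  sumFin≈sum f = reflexive (≡.trans (≡.cong (sumList F) (List.map-tabulate (λ i → i) f)) (sumList-tabulate f))
    where
    sumList-tabulate : ∀ {n} (f : Fin n → Carrier) → sumList F (Data.List.tabulate f) ≡ sum f
    sumList-tabulate {zero}  f = ≡.refl
    sumList-tabulate {suc n} f = ≡.cong (_+_ (f zero)) (sumList-tabulate (f ∘ suc))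

  sum-scale : ∀ {n} a (f : Fin n → Carrier) → sum (λ i → a * f i) ≈ a * sum f
  sum-scale a f = sym (*-distribˡ-sum a f)

  sum-zero : ∀ {n} {f : Fin n → Carrier} → (∀ i → f i ≈ 0#) → sum f ≈ 0#
  sum-zero {zero}  f≈0 = refl
  sum-zero {suc n} f≈0 = trans (+-cong (f≈0 zero) (sum-zero (f≈0 ∘ suc))) (+-identityʳ 0#)

  sum-neg : ∀ {n} (f : Fin n → Carrier) → sum (λ i → - f i) ≈ - sum f
  sum-neg {zero}  f = sym -0#≈0#
  sum-neg {suc n} f = trans (+-congˡ (sum-neg (f ∘ suc))) (-‿+-comm _ _)

  sum-single : ∀ {n} (f : Fin n → Carrier) a → (∀ i → i ≢ a → f i ≈ 0#) → sum f ≈ f a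
  sum-single f zero    f≈0 = trans (+-congˡ (sum-zero (λ i → f≈0 (suc i) λ ()))) (+-identityʳ _)
  sum-single f (suc a) f≈0 = trans (+-cong (f≈0 zero λ ()) (sum-single (f ∘ suc) a f∘suc≈0)) (+-identityˡ _)
    where
    f∘suc≈0 : ∀ i → i ≢ a → f (suc i) ≈ 0#
    f∘suc≈0 i i≢a = f≈0 (suc i) (i≢a ∘ suc-injective)

  sum-nonneg : ∀ {n} {f : Fin n → Carrier} → (∀ i → 0# ≤ f i) → 0# ≤ sum f
  sum-nonneg {zero}  f≥0 = ≤-refl
  sum-nonneg {suc n} f≥0 = ≤-trans (inj₂ (sym (+-identityʳ 0#))) (+-mono-≤ (f≥0 zero) (sum-nonneg (f≥0 ∘ suc)))

  sum-nonpos : ∀ {n} {f : Fin n → Carrier} → (∀ i → f i ≤ 0#) → sum f ≤ 0#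
  sum-nonpos {zero}  f≤0 = ≤-refl
  sum-nonpos {suc n} f≤0 = ≤-trans (+-mono-≤ (f≤0 zero) (sum-nonpos (f≤0 ∘ suc))) (inj₂ (+-identityʳ 0#))

  sum-neg-at : ∀ {n} {f : Fin n → Carrier} a → (∀ i → f i ≤ 0#) → f a < 0# → sum f < 0#
  sum-neg-at zero    f≤0 fa<0 =
    <-≤-trans (+-mono-<-≤ fa<0 (sum-nonpos (f≤0 ∘ suc))) (inj₂ (+-identityʳ 0#))
  sum-neg-at (suc a) f≤0 fa<0 =
    <-≤-trans (≤-<-trans (+-monoˡ-≤ _ (f≤0 zero)) (+-monoʳ-< 0# (sum-neg-at a (f≤0 ∘ suc) fa<0))) (inj₂ (+-identityʳ 0#))

module Weights {c ℓ₁ ℓ₂} (F : OrderedField c ℓ₁ ℓ₂) where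
  open OrderedField F hiding (zero)
  open OrderedFieldProperties F
  private module O = IsStrictTotalOrder isStrictTotalOrder

  module _ {n : ℕ} {e : Edge F n} where
    Joins-sym : ∀ {a b} → Joins F e a b → Joins F e b a
    Joins-sym (inj₁ ends) = inj₂ ends
    Joins-sym (inj₂ ends) = inj₁ ends

    Joins-endpoint : ∀ {a b v l} → Joins F e a b → Joins F e v l → v ≡ a ⊎ v ≡ b
    Joins-endpoint (inj₁ (≡.refl , ≡.refl)) (inj₁ (p , _)) = inj₁ (≡.sym p)
    Joins-endpoint (inj₁ (≡.refl , ≡.refl)) (inj₂ (_ , q)) = inj₂ (≡.sym q)
    Joins-endpoint (inj₂ (≡.refl , ≡.refl)) (inj₁ (p , _)) = inj₂ (≡.sym p)
    Joins-endpoint (inj₂ (≡.refl , ≡.refl)) (inj₂ (_ , q)) = inj₁ (≡.sym q)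

    Joins-unique : ∀ {a b l} → Joins F e a b → Joins F e a l → l ≡ b
    Joins-unique (inj₁ (≡.refl , ≡.refl)) (inj₁ (_ , q)) = ≡.sym q
    Joins-unique (inj₁ (≡.refl , ≡.refl)) (inj₂ (_ , q)) = ⊥-elim (Edge.loopless e (≡.sym q))
    Joins-unique (inj₂ (≡.refl , ≡.refl)) (inj₁ (p , _)) = ⊥-elim (Edge.loopless e p)
    Joins-unique (inj₂ (≡.refl , ≡.refl)) (inj₂ (q , _)) = ≡.sym q

    joins?⇒Joins : ∀ {a b} → T (joins? F e a b) → Joins F e a b
    joins?⇒Joins {a} {b} j with Edge.end₁ e ≟ a | Edge.end₂ e ≟ b | Edge.end₁ e ≟ b | Edge.end₂ e ≟ a
    ... | yes p | yes q | _     | _     = inj₁ (p , q)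
    ... | _     | _     | yes p | yes q = inj₂ (p , q)
    ... | no _  | _     | no _  | _     = ⊥-elim j
    ... | no _  | _     | yes _ | no _  = ⊥-elim j
    ... | yes _ | no _  | no _  | _     = ⊥-elim j
    ... | yes _ | no _  | yes _ | no _  = ⊥-elim j

    joins?-comm : ∀ a b → joins? F e a b ≡ joins? F e b a
    joins?-comm a b = Bool.∨-comm (⌊ Edge.end₁ e ≟ a ⌋ ∧ ⌊ Edge.end₂ e ≟ b ⌋) _

    Joins⇒joins? : ∀ {a b} → Joins F e a b → T (joins? F e a b)
    Joins⇒joins? {a} {b} (inj₁ (p , q)) with Edge.end₁ e ≟ a | Edge.end₂ e ≟ b
    ... | yes _ | yes _ = _
    ... | no p̸ | _     = ⊥-elim (p̸ p)
    ... | yes _ | no q̸ = ⊥-elim (q̸ q)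
    Joins⇒joins? {a} {b} (inj₂ ends) = ≡.subst T (joins?-comm b a) (Joins⇒joins? (inj₁ ends))

  module _ {n : ℕ} where
    weightOf : Fin n → Fin n → Edge F n → Carrier
    weightOf a b e = if joins? F e a b then Edge.weight e else 0#

    weightBetween-comm : ∀ (G : Multigraph F n) a b → weightBetween F G a b ≡ weightBetween F G b a
    weightBetween-comm G a b =
      ≡.cong (sumList F) (List.map-cong (λ e → ≡.cong (λ j → if j then Edge.weight e else 0#) (joins?-comm {e = e} a b)) G)

    weightOf-nonneg : ∀ a b e → 0# ≤ weightOf a b e
    weightOf-nonneg a b e with joins? F e a b
    ... | true  = <⇒≤ (Edge.positive e)
    ... | false = ≤-refl

    weightBetween-nonneg : ∀ (G : Multigraph F n) a b → 0# ≤ weightBetween F G a b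
    weightBetween-nonneg []      a b = ≤-refl
    weightBetween-nonneg (e ∷ G) a b =
      ≤-trans (inj₂ (sym (+-identityʳ 0#))) (+-mono-≤ (weightOf-nonneg a b e) (weightBetween-nonneg G a b))

    weightBetween-pos : ∀ (G : Multigraph F n) p {a b} → Joins F (lookup G p) a b → 0# < weightBetween F G a b
    weightBetween-pos (e ∷ G) zero {a} {b} j with joins? F e a b | Joins⇒joins? {e = e} j
    ... | true | _ = <-≤-trans (Edge.positive e) (≤-trans (inj₂ (sym (+-identityʳ _))) (+-monoʳ-≤ _ (weightBetween-nonneg G a b)))
    weightBetween-pos (e ∷ G) (suc p) {a} {b} j =
      <-≤-trans (weightBetween-pos G p j) (≤-trans (inj₂ (sym (+-identityˡ _))) (+-monoˡ-≤ _ (weightOf-nonneg a b e)))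

    weightBetween-pos⇒edge : ∀ (G : Multigraph F n) {a b} → 0# < weightBetween F G a b →
                             ∃ λ p → Joins F (lookup G p) a b
    weightBetween-pos⇒edge []      0<0 = ⊥-elim (<-irrefl 0<0)
    weightBetween-pos⇒edge (e ∷ G) {a} {b} 0<w with joins? F e a b in joined
    ... | true  = zero , joins?⇒Joins {e = e} (Equivalence.from Bool.T-≡ joined)
    ... | false with weightBetween-pos⇒edge G (O.<-respʳ-≈ (+-identityˡ _) 0<w)
    ...   | p , j = suc p , j

module MatrixProperties {c ℓ₁ ℓ₂} (F : OrderedField c ℓ₁ ℓ₂) where
  open OrderedField F hiding (zero)
  open Summation F
  open import Relation.Binary.Reasoning.Setoid setoid

  infixl 7 _⊗ᶠ_
  _⊗ᶠ_ : ∀ {n} → Matrix F n → Matrix F n → Matrix F n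
  _⊗ᶠ_ = _⊗_ F

  module _ {n : ℕ} where
    identity-comm : ∀ (i j : Fin n) → identity F i j ≡ identity F j i
    identity-comm i j with i ≟ j | j ≟ i
    ... | yes _   | yes _   = ≡.refl
    ... | no _    | no _    = ≡.refl
    ... | yes i≡j | no j≢i  = ⊥-elim (j≢i (≡.sym i≡j))
    ... | no i≢j  | yes j≡i = ⊥-elim (i≢j (≡.sym j≡i))

    identity-diag : ∀ (i : Fin n) → identity F i i ≈ 1#
    identity-diag i with i ≟ i
    ... | yes _ = refl
    ... | no i≢i = ⊥-elim (i≢i ≡.refl)

    identity-off : ∀ {i j : Fin n} → i ≢ j → identity F i j ≈ 0#
    identity-off {i} {j} i≢j with i ≟ j
    ... | yes i≡j = ⊥-elim (i≢j i≡j)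
    ... | no _    = refl

    sum-*-identity : ∀ (f : Fin n → Carrier) a → sum (λ j → f j * identity F j a) ≈ f a
    sum-*-identity f a = begin
      sum (λ j → f j * identity F j a) ≈⟨ sum-single _ a (λ j j≢a → trans (*-congˡ (identity-off j≢a)) (zeroʳ _)) ⟩
      f a * identity F a a             ≈⟨ trans (*-congˡ (identity-diag a)) (*-identityʳ _) ⟩
      f a                              ∎

    sum-identity-* : ∀ (f : Fin n → Carrier) a → sum (λ j → identity F a j * f j) ≈ f a
    sum-identity-* f a = trans (sum-cong-≋ (λ j → trans (*-comm _ _) (reflexive (≡.cong (f j *_) (identity-comm a j)))))
                               (sum-*-identity f a)

    unitDifference : Fin n → Fin n → Fin n → Carrier
    unitDifference a b j = identity F a j - identity F b j

    sum-*-unitDifference : ∀ (f : Fin n → Carrier) a b → sum (λ j → f j * unitDifference a b j) ≈ f a - f b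
    sum-*-unitDifference f a b = begin
      sum (λ j → f j * unitDifference a b j)
        ≈⟨ sum-cong-≋ split ⟩
      sum (λ j → identity F a j * f j + - (identity F b j * f j))
        ≈⟨ ∑-distrib-+ (λ j → identity F a j * f j) _ ⟩
      sum (λ j → identity F a j * f j) + sum (λ j → - (identity F b j * f j))
        ≈⟨ +-congˡ (sum-neg (λ j → identity F b j * f j)) ⟩
      sum (λ j → identity F a j * f j) - sum (λ j → identity F b j * f j)
        ≈⟨ +-cong (sum-identity-* f a) (-‿cong (sum-identity-* f b)) ⟩
      f a - f b ∎
      where
      open import Algebra.Properties.Ring ring using (x[y-z]≈xy-xz)
      split : ∀ j → f j * unitDifference a b j ≈ identity F a j * f j + - (identity F b j * f j)
      split j = trans (x[y-z]≈xy-xz (f j) _ _) (+-cong (*-comm _ _) (-‿cong (*-comm _ _)))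

    ⊗-identityʳ : ∀ (A : Matrix F n) i j → (A ⊗ᶠ identity F) i j ≈ A i j
    ⊗-identityʳ A i j = trans (sumFin≈sum (λ l → A i l * identity F l j)) (sum-*-identity (A i) j)

    ⊗-assoc : ∀ (A B C : Matrix F n) i j → (A ⊗ᶠ B ⊗ᶠ C) i j ≈ (A ⊗ᶠ (B ⊗ᶠ C)) i j
    ⊗-assoc A B C i j = begin
      (A ⊗ᶠ B ⊗ᶠ C) i j
        ≈⟨ sumFin≈sum (λ l → (A ⊗ᶠ B) i l * C l j) ⟩
      sum (λ l → (A ⊗ᶠ B) i l * C l j)
        ≈⟨ sum-cong-≋ (λ l → *-congʳ (sumFin≈sum (λ m → A i m * B m l))) ⟩
      sum (λ l → sum (λ m → A i m * B m l) * C l j)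
        ≈⟨ sum-cong-≋ (λ l → *-distribʳ-sum (C l j) (λ m → A i m * B m l)) ⟩
      sum (λ l → sum (λ m → A i m * B m l * C l j))
        ≈⟨ ∑-comm (λ l m → A i m * B m l * C l j) ⟩
      sum (λ m → sum (λ l → A i m * B m l * C l j))
        ≈⟨ sum-cong-≋ (λ m → sum-cong-≋ (λ l → *-assoc (A i m) (B m l) (C l j))) ⟩
      sum (λ m → sum (λ l → A i m * (B m l * C l j)))
        ≈⟨ sum-cong-≋ (λ m → *-distribˡ-sum (A i m) (λ l → B m l * C l j)) ⟨
      sum (λ m → A i m * sum (λ l → B m l * C l j))
        ≈⟨ sum-cong-≋ (λ m → *-congˡ (sumFin≈sum (λ l → B m l * C l j))) ⟨
      sum (λ m → A i m * (B ⊗ᶠ C) m j)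
        ≈⟨ sumFin≈sum (λ m → A i m * (B ⊗ᶠ C) m j) ⟨
      (A ⊗ᶠ (B ⊗ᶠ C)) i j ∎

    ⊗-cong : ∀ {A A′ B B′ : Matrix F n} → (∀ i j → A i j ≈ A′ i j) → (∀ i j → B i j ≈ B′ i j) →
             ∀ i j → (A ⊗ᶠ B) i j ≈ (A′ ⊗ᶠ B′) i j
    ⊗-cong {A} {A′} {B} {B′} A≈A′ B≈B′ i j = begin
      (A ⊗ᶠ B) i j               ≈⟨ sumFin≈sum (λ l → A i l * B l j) ⟩
      sum (λ l → A i l * B l j)   ≈⟨ sum-cong-≋ (λ l → *-cong (A≈A′ i l) (B≈B′ l j)) ⟩
      sum (λ l → A′ i l * B′ l j) ≈⟨ sumFin≈sum (λ l → A′ i l * B′ l j) ⟨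
      (A′ ⊗ᶠ B′) i j             ∎

  module RankOneUpdate {n : ℕ} {A A′ Q Q′ : Matrix F n} (δ : Carrier) (u : Fin n → Carrier)
                       (A′≈A+δuuᵀ : ∀ v l → A′ v l ≈ A v l + δ * (u v * u l))
                       (QA≈I : ∀ i j → (Q ⊗ᶠ A) i j ≈ identity F i j)
                       (A′Q′≈I : ∀ i j → (A′ ⊗ᶠ Q′) i j ≈ identity F i j) where
    open IntegerRingSolver commutativeRing using (solve; _:=_; _:*_)

    Qu : Fin n → Carrier
    Qu i = sum (λ v → Q i v * u v)

    uQ′ : Fin n → Carrier
    uQ′ j = sum (λ l → u l * Q′ l j)

    QA′≈I+δQuuᵀ : ∀ i l → (Q ⊗ᶠ A′) i l ≈ identity F i l + δ * (Qu i * u l)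
    QA′≈I+δQuuᵀ i l = begin
      (Q ⊗ᶠ A′) i l
        ≈⟨ sumFin≈sum (λ v → Q i v * A′ v l) ⟩
      sum (λ v → Q i v * A′ v l)
        ≈⟨ sum-cong-≋ (λ v → *-congˡ (A′≈A+δuuᵀ v l)) ⟩
      sum (λ v → Q i v * (A v l + δ * (u v * u l)))
        ≈⟨ sum-cong-≋ (λ v → distribˡ (Q i v) _ _) ⟩
      sum (λ v → Q i v * A v l + Q i v * (δ * (u v * u l)))
        ≈⟨ ∑-distrib-+ (λ v → Q i v * A v l) _ ⟩
      sum (λ v → Q i v * A v l) + sum (λ v → Q i v * (δ * (u v * u l)))
        ≈⟨ +-cong (sym (sumFin≈sum (λ v → Q i v * A v l))) (sum-cong-≋ (λ v → regroup (Q i v) δ (u v) (u l))) ⟩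
      (Q ⊗ᶠ A) i l + sum (λ v → (δ * u l) * (Q i v * u v))
        ≈⟨ +-cong (QA≈I i l) (sum-scale (δ * u l) (λ v → Q i v * u v)) ⟩
      identity F i l + (δ * u l) * Qu i
        ≈⟨ +-congˡ (regroup′ δ (u l) (Qu i)) ⟩
      identity F i l + δ * (Qu i * u l) ∎
      where
      regroup : ∀ q d x y → q * (d * (x * y)) ≈ (d * y) * (q * x)
      regroup = solve 4 (λ q d x y → q :* (d :* (x :* y)) := (d :* y) :* (q :* x)) refl
      regroup′ : ∀ d y c → (d * y) * c ≈ d * (c * y)
      regroup′ = solve 3 (λ d y c → (d :* y) :* c := d :* (c :* y)) refl

    sherman-morrison : ∀ i j → Q i j ≈ Q′ i j + δ * (Qu i * uQ′ j)
    sherman-morrison i j = begin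
      Q i j
        ≈⟨ ⊗-identityʳ Q i j ⟨
      (Q ⊗ᶠ identity F) i j
        ≈⟨ ⊗-cong {A = Q} (λ _ _ → refl) (λ v l → sym (A′Q′≈I v l)) i j ⟩
      (Q ⊗ᶠ (A′ ⊗ᶠ Q′)) i j
        ≈⟨ ⊗-assoc Q A′ Q′ i j ⟨
      (Q ⊗ᶠ A′ ⊗ᶠ Q′) i j
        ≈⟨ sumFin≈sum (λ l → (Q ⊗ᶠ A′) i l * Q′ l j) ⟩
      sum (λ l → (Q ⊗ᶠ A′) i l * Q′ l j)
        ≈⟨ sum-cong-≋ (λ l → *-congʳ (QA′≈I+δQuuᵀ i l)) ⟩
      sum (λ l → (identity F i l + δ * (Qu i * u l)) * Q′ l j)
        ≈⟨ sum-cong-≋ (λ l → distribʳ (Q′ l j) _ _) ⟩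
      sum (λ l → identity F i l * Q′ l j + δ * (Qu i * u l) * Q′ l j)
        ≈⟨ ∑-distrib-+ (λ l → identity F i l * Q′ l j) _ ⟩
      sum (λ l → identity F i l * Q′ l j) + sum (λ l → δ * (Qu i * u l) * Q′ l j)
        ≈⟨ +-cong (sum-identity-* (λ l → Q′ l j) i) (sum-cong-≋ (λ l → regroup δ (Qu i) (u l) (Q′ l j))) ⟩
      Q′ i j + sum (λ l → (δ * Qu i) * (u l * Q′ l j))
        ≈⟨ +-congˡ (sum-scale (δ * Qu i) (λ l → u l * Q′ l j)) ⟩
      Q′ i j + (δ * Qu i) * uQ′ j
        ≈⟨ +-congˡ (*-assoc δ (Qu i) (uQ′ j)) ⟩
      Q′ i j + δ * (Qu i * uQ′ j) ∎
      where
      regroup : ∀ d c x q → d * (c * x) * q ≈ (d * c) * (x * q)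
      regroup = solve 4 (λ d c x q → d :* (c :* x) :* q := (d :* c) :* (x :* q)) refl

module Laplacian {c ℓ₁ ℓ₂} (F : OrderedField c ℓ₁ ℓ₂) where
  open OrderedField F hiding (zero)
  open OrderedFieldProperties F
  open Summation F
  open MatrixProperties F using (sum-identity-*; identity-comm)
  open Weights F using (weightBetween-comm)
  open import Algebra.Properties.Ring ring using (-‿involutive; -0#≈0#; x[y-z]≈xy-xz; -‿distribˡ-*)
  open import Relation.Binary.Reasoning.Setoid setoid

  module _ {n : ℕ} where
    -- The term l = v vanishes, so no guard l ≢ v is needed whatever w v v is.
    laplacian : (Fin n → Fin n → Carrier) → (Fin n → Carrier) → Fin n → Carrier
    laplacian w x v = sum (λ l → w v l * (x v - x l))

    private
      offDiagonalWeight : Multigraph F n → Fin n → Fin n → Carrier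
      offDiagonalWeight G v l = if ⌊ v ≟ l ⌋ then 0# else weightBetween F G v l

      offDiagonalKirchhoff : Multigraph F n → Fin n → Fin n → Carrier
      offDiagonalKirchhoff G v l = if ⌊ v ≟ l ⌋ then 0# else - weightBetween F G v l

      degree : Multigraph F n → Fin n → Carrier
      degree G v = - sumFin F (offDiagonalKirchhoff G v)

      degree≈sum : ∀ G v → degree G v ≈ sum (offDiagonalWeight G v)
      degree≈sum G v = begin
        - sumFin F (offDiagonalKirchhoff G v)          ≈⟨ -‿cong (sumFin≈sum (offDiagonalKirchhoff G v)) ⟩
        - sum (offDiagonalKirchhoff G v)               ≈⟨ sum-neg (offDiagonalKirchhoff G v) ⟨
        sum (λ l → - offDiagonalKirchhoff G v l)        ≈⟨ sum-cong-≋ negate ⟩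
        sum (offDiagonalWeight G v)                    ∎
        where
        negate : ∀ l → - offDiagonalKirchhoff G v l ≈ offDiagonalWeight G v l
        negate l with v ≟ l
        ... | yes _ = -0#≈0#
        ... | no _  = -‿involutive _

      kirchhoff-term : ∀ G (x : Fin n → Carrier) v l →
        kirchhoff F G v l * x l ≈ identity F v l * (degree G v * x v) + - (offDiagonalWeight G v l * x l)
      kirchhoff-term G x v l with v ≟ l
      ... | yes ≡.refl = sym (trans (+-cong (*-identityˡ _) (trans (-‿cong (zeroˡ _)) -0#≈0#)) (+-identityʳ _))
      ... | no _       = sym (trans (+-congʳ (zeroˡ _)) (trans (+-identityˡ _) (-‿distribˡ-* _ (x l))))

    kirchhoff-apply : ∀ G (x : Fin n → Carrier) v →
                      sumFin F (λ l → kirchhoff F G v l * x l) ≈ laplacian (weightBetween F G) x v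
    kirchhoff-apply G x v = begin
      sumFin F (λ l → kirchhoff F G v l * x l)
        ≈⟨ sumFin≈sum (λ l → kirchhoff F G v l * x l) ⟩
      sum (λ l → kirchhoff F G v l * x l)
        ≈⟨ sum-cong-≋ (kirchhoff-term G x v) ⟩
      sum (λ l → identity F v l * (degree G v * x v) + - (w̃ l * x l))
        ≈⟨ ∑-distrib-+ (λ l → identity F v l * (degree G v * x v)) _ ⟩
      sum (λ l → identity F v l * (degree G v * x v)) + sum (λ l → - (w̃ l * x l))
        ≈⟨ +-cong (sum-identity-* (λ _ → degree G v * x v) v) (sum-neg (λ l → w̃ l * x l)) ⟩
      degree G v * x v - sum (λ l → w̃ l * x l)
        ≈⟨ +-congʳ (trans (*-congʳ (degree≈sum G v)) (*-distribʳ-sum (x v) w̃)) ⟩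
      sum (λ l → w̃ l * x v) - sum (λ l → w̃ l * x l)
        ≈⟨ +-congˡ (sum-neg (λ l → w̃ l * x l)) ⟨
      sum (λ l → w̃ l * x v) + sum (λ l → - (w̃ l * x l))
        ≈⟨ ∑-distrib-+ (λ l → w̃ l * x v) _ ⟨
      sum (λ l → w̃ l * x v - w̃ l * x l)
        ≈⟨ sum-cong-≋ (λ l → trans (sym (x[y-z]≈xy-xz (w̃ l) (x v) (x l))) (onDiagonal l)) ⟩
      laplacian (weightBetween F G) x v ∎
      where
      w̃ : Fin n → Carrier
      w̃ = offDiagonalWeight G v
      onDiagonal : ∀ l → w̃ l * (x v - x l) ≈ weightBetween F G v l * (x v - x l)
      onDiagonal l with v ≟ l
      ... | yes ≡.refl = trans (zeroˡ _) (sym (trans (*-congˡ (-‿inverseʳ (x v))) (zeroʳ _)))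
      ... | no _       = refl

    IplusL-comm : ∀ G (v l : Fin n) → IplusL F G v l ≡ IplusL F G l v
    IplusL-comm G v l = ≡.cong₂ _+_ (identity-comm v l) kirchhoff-comm
      where
      kirchhoff-comm : kirchhoff F G v l ≡ kirchhoff F G l v
      kirchhoff-comm with v ≟ l | l ≟ v
      ... | yes ≡.refl | yes _   = ≡.refl
      ... | yes v≡l    | no l≢v  = ⊥-elim (l≢v (≡.sym v≡l))
      ... | no v≢l     | yes l≡v = ⊥-elim (v≢l (≡.sym l≡v))
      ... | no _       | no _    = ≡.cong -_ (weightBetween-comm G v l)

    IplusL-apply : ∀ G (x : Fin n → Carrier) v →
                   sumFin F (λ l → IplusL F G v l * x l) ≈ x v + laplacian (weightBetween F G) x v
    IplusL-apply G x v = begin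
      sumFin F (λ l → IplusL F G v l * x l)
        ≈⟨ sumFin≈sum (λ l → IplusL F G v l * x l) ⟩
      sum (λ l → (identity F v l + kirchhoff F G v l) * x l)
        ≈⟨ sum-cong-≋ (λ l → distribʳ (x l) _ _) ⟩
      sum (λ l → identity F v l * x l + kirchhoff F G v l * x l)
        ≈⟨ ∑-distrib-+ (λ l → identity F v l * x l) _ ⟩
      sum (λ l → identity F v l * x l) + sum (λ l → kirchhoff F G v l * x l)
        ≈⟨ +-cong (sum-identity-* x v) (trans (sym (sumFin≈sum (λ l → kirchhoff F G v l * x l))) (kirchhoff-apply G x v)) ⟩
      x v + laplacian (weightBetween F G) x v ∎

    laplacian-+ : ∀ (w w′ : Fin n → Fin n → Carrier) x v →
                  laplacian (λ a b → w a b + w′ a b) x v ≈ laplacian w x v + laplacian w′ x v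
    laplacian-+ w w′ x v =
      trans (sum-cong-≋ (λ l → distribʳ (x v - x l) (w v l) (w′ v l))) (∑-distrib-+ (λ l → w v l * (x v - x l)) _)

    module _ {w : Fin n → Fin n → Carrier} {x : Fin n → Carrier} {v : Fin n} (w≥0 : ∀ l → 0# ≤ w v l) where
      laplacian-nonpos-at-min : (∀ l → x v ≤ x l) → laplacian w x v ≤ 0#
      laplacian-nonpos-at-min v-min = sum-nonpos (λ l → *-nonneg-nonpos (w≥0 l) (x≤y⇒x-y≤0 (v-min l)))

      laplacian-neg-at-min : (∀ l → x v ≤ x l) → ∀ a → 0# < w v a → x v < x a → laplacian w x v < 0#
      laplacian-neg-at-min v-min a 0<w xv<xa =
        sum-neg-at a (λ l → *-nonneg-nonpos (w≥0 l) (x≤y⇒x-y≤0 (v-min l))) (*-pos-neg 0<w (x<y⇒x-y<0 xv<xa))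

      laplacian-nonneg-without-ascent : (∀ l → x v < x l → w v l ≈ 0#) → 0# ≤ laplacian w x v
      laplacian-nonneg-without-ascent no-ascent = sum-nonneg term
        where
        term : ∀ l → 0# ≤ w v l * (x v - x l)
        term l with x v <? x l
        ... | yes xv<xl = inj₂ (sym (trans (*-congʳ (no-ascent l xv<xl)) (zeroˡ _)))
        ... | no xv≮xl  = *-nonneg (w≥0 l) (x≤y⇒0≤y-x (≮⇒≥ xv≮xl))

module Walks {c ℓ₁ ℓ₂} (F : OrderedField c ℓ₁ ℓ₂) where
  open Weights F using (Joins-endpoint)

  module _ {n : ℕ} {G : Multigraph F n} where
    source∈walkVertices : ∀ {a b} (w : Walk F G a b) → a ∈ walkVertices F w
    source∈walkVertices here         = here ≡.refl
    source∈walkVertices (step _ _ _) = here ≡.refl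

    endpoint∈walkVertices : ∀ {a b} (w : Walk F G a b) {p l v} → p ∈ walkEdges F w →
                            Joins F (lookup G p) l v → l ∈ walkVertices F w
    endpoint∈walkVertices (step q j w) (here ≡.refl) j′ with Joins-endpoint {e = lookup G q} j j′
    ... | inj₁ ≡.refl = here ≡.refl
    ... | inj₂ ≡.refl = there (source∈walkVertices w)
    endpoint∈walkVertices (step q j w) (there p∈w) j′ = there (endpoint∈walkVertices w p∈w j′)

    separated-self : ∀ a b → Separated F G a b a
    separated-self a b = path here ([] ∷ [] , []) , λ P → source∈walkVertices (Path.walk P)

module MaximumPrinciple {c ℓ₁ ℓ₂} (F : OrderedField c ℓ₁ ℓ₂) where
  open OrderedField F hiding (zero)
  open OrderedFieldProperties F
  open Weights F
  open Walks F
  open Laplacian F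
  open MatrixProperties F using (identity-diag; identity-off)
  open import Relation.Binary.Properties.StrictTotalOrder strictTotalOrder using (decTotalOrder)
  open import Relation.Binary.Bundles using (DecTotalOrder)
  open import Data.List.Extrema (DecTotalOrder.totalOrder decTotalOrder) using (argmin; f[argmin]≤f[xs])

  IsResolventColumn : ∀ {n} → Multigraph F n → Fin n → (Fin n → Carrier) → Set ℓ₁
  IsResolventColumn G s x = ∀ v → sumFin F (λ l → IplusL F G v l * x l) ≈ identity F v s

  identity-nonneg : ∀ {n} (v s : Fin n) → 0# ≤ identity F v s
  identity-nonneg v s with v ≟ s
  ... | yes _ = <⇒≤ 0<1
  ... | no _  = ≤-refl

  module ResolventColumn {n} {G : Multigraph F n} {s : Fin n} {x : Fin n → Carrier}
                         (resolvent : IsResolventColumn G s x) where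
    open ≤-Reasoning

    private
      W : Fin n → Fin n → Carrier
      W = weightBetween F G

      W≥0 : ∀ v l → 0# ≤ W v l
      W≥0 = weightBetween-nonneg G

      equation : ∀ v → x v + laplacian W x v ≈ identity F v s
      equation v = trans (sym (IplusL-apply G x v)) (resolvent v)

      nonneg-at-min : ∀ {m} → (∀ l → x m ≤ x l) → 0# ≤ x m
      nonneg-at-min {m} m-min = begin
        0#                     ≤⟨ identity-nonneg m s ⟩
        identity F m s         ≈⟨ equation m ⟨
        x m + laplacian W x m  ≤⟨ +-monoʳ-≤ (x m) (laplacian-nonpos-at-min {w = W} (W≥0 m) m-min) ⟩
        x m + 0#               ≈⟨ +-identityʳ (x m) ⟩
        x m                    ∎

    nonneg : ∀ v → 0# ≤ x v
    nonneg v = ≤-trans (nonneg-at-min m-min) (m-min v)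
      where
      m-min : ∀ l → x (argmin x v (allFin n)) ≤ x l
      m-min l = All.lookup (f[argmin]≤f[xs] v (allFin n)) (∈-allFin l)

    source-pos : 0# < x s
    source-pos = ≰⇒> λ xs≤0 → ≤⇒≯ (begin
      1#
        ≈⟨ identity-diag s ⟨
      identity F s s
        ≈⟨ equation s ⟨
      x s + laplacian W x s
        ≤⟨ +-mono-≤ xs≤0 (laplacian-nonpos-at-min {w = W} (W≥0 s) (λ l → ≤-trans xs≤0 (nonneg l))) ⟩
      0# + 0#
        ≈⟨ +-identityʳ 0# ⟩
      0# ∎) 0<1

    pos-adjacent : ∀ {a b} → 0# < W b a → 0# < x a → 0# < x b
    pos-adjacent {a} {b} 0<W 0<xa = ≰⇒> λ xb≤0 → ≤⇒≯ (identity-nonneg b s) (begin-strict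
      identity F b s         ≈⟨ equation b ⟨
      x b + laplacian W x b  <⟨ +-mono-≤-< xb≤0 (laplacian-neg-at-min {w = W} (W≥0 b) (λ l → ≤-trans xb≤0 (nonneg l)) a 0<W
                                                  (≤-<-trans xb≤0 0<xa)) ⟩
      0# + 0#                ≈⟨ +-identityʳ 0# ⟩
      0#                     ∎)

    pos-along-walk : ∀ {a b} → Walk F G a b → 0# < x a → 0# < x b
    pos-along-walk here         0<xa = 0<xa
    pos-along-walk (step p j w) 0<xa = pos-along-walk w (pos-adjacent (weightBetween-pos G p (Joins-sym {e = lookup G p} j)) 0<xa)

    ascent : ∀ {v} → v ≢ s → 0# < x v → ∃ λ l → x v < x l × 0# < W v l
    ascent {v} v≢s 0<xv with any? (λ l → (x v <? x l) ×-dec (0# <? W v l))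
    ... | yes found = found
    ... | no none   = ⊥-elim (<-irrefl (begin-strict
      0#                     <⟨ 0<xv ⟩
      x v                    ≈⟨ +-identityʳ (x v) ⟨
      x v + 0#               ≤⟨ +-monoʳ-≤ (x v) (laplacian-nonneg-without-ascent {w = W} (W≥0 v) flat) ⟩
      x v + laplacian W x v  ≈⟨ equation v ⟩
      identity F v s         ≈⟨ identity-off v≢s ⟩
      0#                     ∎))
      where
      flat : ∀ l → x v < x l → W v l ≈ 0#
      flat l xv<xl = ≤-antisym (≮⇒≥ (λ 0<W → none (l , xv<xl , 0<W))) (W≥0 v l)

    separated⇒decreasing : ∀ {a b} → a ≢ b → Separated F G a b s → x b < x a
    separated⇒decreasing {a} {b} a≢b (to-a , hits-a) =
      ≰⇒> λ xa≤xb → climb b (uphill-wellFounded b) xa≤xb here ([] ∷ [] , []) ((≤-refl , a≢b ∘ ≡.sym) ∷ [])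
      where
      uphill-wellFounded : WellFounded (flip (_<_ on x))
      uphill-wellFounded = spo-noetherian (On.isStrictPartialOrder x (IsStrictTotalOrder.isStrictPartialOrder isStrictTotalOrder))

      0<xa : 0# < x a
      0<xa = pos-along-walk (Path.walk to-a) source-pos

      Below : Fin n → Fin n → Set (ℓ₁ ⊔ ℓ₂)
      Below v u = x u ≤ x v × u ≢ a

      -- Invariant: w is a path from v to b whose vertices lie below v and avoid a. Each step
      -- prepends a neighbour with a strictly larger value, until v = s contradicts separation.
      climb : ∀ v → Acc (flip (_<_ on x)) v → x a ≤ x v → (w : Walk F G v b) → IsPath F w →
              All (Below v) (walkVertices F w) → ⊥
      climb v (acc higher) xa≤xv w w-path below with v ≟ s
      ... | yes ≡.refl = proj₂ (All.lookup below (hits-a (path w w-path))) ≡.refl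
      ... | no v≢s with ascent v≢s (<-≤-trans 0<xa xa≤xv)
      ...   | l , xv<xl , 0<W with weightBetween-pos⇒edge G (≡.subst (0# <_) (weightBetween-comm G v l) 0<W)
      ...     | p , j = climb l (higher xv<xl) (≤-trans xa≤xv (<⇒≤ xv<xl)) (step p j w) extended extended-below
        where
        l∉w : ∀ {u} → u ∈ walkVertices F w → l ≢ u
        l∉w u∈w ≡.refl = ≤⇒≯ (proj₁ (All.lookup below u∈w)) xv<xl
        extended : IsPath F (step p j w)
        extended = (All.tabulate l∉w ∷ proj₁ w-path)
                 , (All.tabulate (λ { p∈w ≡.refl → l∉w (endpoint∈walkVertices w p∈w j) ≡.refl }) ∷ proj₂ w-path)
        extended-below : All (Below l) (l ∷ walkVertices F w)
        extended-below = (≤-refl , λ { ≡.refl → ≤⇒≯ xa≤xv xv<xl })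
                       ∷ All.map (λ (xu≤xv , u≢a) → ≤-trans xu≤xv (<⇒≤ xv<xl) , u≢a) below

module EdgeIncrease {c ℓ₁ ℓ₂} (F : OrderedField c ℓ₁ ℓ₂) where
  open OrderedField F hiding (zero)
  open OrderedFieldProperties F
  open IntegerRingSolver commutativeRing using (solve; _:=_; _:+_; _:-_; _:*_; con)
  open Summation F
  open Weights F
  open Laplacian F
  open MatrixProperties F using (⊗-identityʳ; identity-diag; identity-off; unitDifference)
  open import Relation.Binary.Reasoning.Setoid setoid

  private
    if-true : ∀ {b} {x y : Carrier} → T b → (if b then x else y) ≡ x
    if-true {true} _ = ≡.refl

    if-false : ∀ {b} {x y : Carrier} → ¬ T b → (if b then x else y) ≡ y
    if-false {false} _  = ≡.refl
    if-false {true}  ¬t = ⊥-elim (¬t _)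

    sumList-++ : ∀ (xs ys : List Carrier) → sumList F (xs ++ ys) ≈ sumList F xs + sumList F ys
    sumList-++ []       ys = sym (+-identityˡ _)
    sumList-++ (x ∷ xs) ys = trans (+-congˡ (sumList-++ xs ys)) (sym (+-assoc _ _ _))

    sumList-[]∷= : ∀ {a} {A : Set a} (f : A → Carrier) (xs : List A) p y →
                   sumList F (map f (xs [ p ]∷= y)) ≈ sumList F (map f xs) + (f y - f (lookup xs p))
    sumList-[]∷= f (x ∷ xs) zero    y = replace (f x) (f y) _
      where
      replace : ∀ a b s → b + s ≈ (a + s) + (b - a)
      replace = solve 3 (λ a b s → b :+ s := (a :+ s) :+ (b :- a)) refl
    sumList-[]∷= f (x ∷ xs) (suc p) y = trans (+-congˡ (sumList-[]∷= f xs p y)) (sym (+-assoc _ _ _))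

  record WeightIncrease {n} (k t : Fin n) (G G′ : Multigraph F n) : Set (c ⊔ ℓ₁ ⊔ ℓ₂) where
    field
      raised : Edge F n
      joins  : Joins F raised k t
      δ      : Carrier
      δ>0    : 0# < δ
      weightBetween-increase : ∀ a b → weightBetween F G′ a b ≈ weightBetween F G a b + (if joins? F raised a b then δ else 0#)

  perturbation⇒weightIncrease : ∀ {n} {k t : Fin n} {G G′} → Perturbation F k t G G′ → WeightIncrease k t G G′
  perturbation⇒weightIncrease {G = G} (inj₁ (p , e′ , joins-kt , same-end₁ , same-end₂ , w<w′ , ≡.refl)) = record
    { raised = e′
    ; joins  = same-ends joins-kt
    ; δ      = Edge.weight e′ - Edge.weight e
    ; δ>0    = x<y⇒0<y-x w<w′
    ; weightBetween-increase = λ a b → trans (sumList-[]∷= (weightOf a b) G p e′) (+-congˡ (difference a b))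
    }
    where
    e = lookup G p
    same-ends : ∀ {a b} → Joins F e a b → Joins F e′ a b
    same-ends (inj₁ (p₁ , p₂)) = inj₁ (≡.trans same-end₁ p₁ , ≡.trans same-end₂ p₂)
    same-ends (inj₂ (p₁ , p₂)) = inj₂ (≡.trans same-end₁ p₁ , ≡.trans same-end₂ p₂)
    same-joins? : ∀ a b → joins? F e′ a b ≡ joins? F e a b
    same-joins? a b = ≡.cong₂ (λ x y → (⌊ x ≟ a ⌋ ∧ ⌊ y ≟ b ⌋) ∨ (⌊ x ≟ b ⌋ ∧ ⌊ y ≟ a ⌋)) same-end₁ same-end₂
    difference : ∀ a b → weightOf a b e′ - weightOf a b e ≈ (if joins? F e′ a b then Edge.weight e′ - Edge.weight e else 0#)
    difference a b rewrite same-joins? a b with joins? F e a b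
    ... | true  = refl
    ... | false = -‿inverseʳ 0#
  perturbation⇒weightIncrease {G = G} (inj₂ (e′ , joins-kt , ≡.refl)) = record
    { raised = e′
    ; joins  = joins-kt
    ; δ      = Edge.weight e′
    ; δ>0    = Edge.positive e′
    ; weightBetween-increase = λ a b → begin
        weightBetween F (G ++ [ e′ ]) a b
          ≡⟨ ≡.cong (sumList F) (List.map-++ (weightOf a b) G [ e′ ]) ⟩
        sumList F (map (weightOf a b) G ++ [ weightOf a b e′ ])
          ≈⟨ sumList-++ (map (weightOf a b) G) _ ⟩
        weightBetween F G a b + (weightOf a b e′ + 0#)
          ≈⟨ +-congˡ (+-identityʳ _) ⟩
        weightBetween F G a b + weightOf a b e′ ∎
    }

  module _ {n} {k t : Fin n} {G G′ : Multigraph F n} (k≢t : k ≢ t) (increase : WeightIncrease k t G G′) where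
    open WeightIncrease increase

    raisedWeight : Fin n → Fin n → Carrier
    raisedWeight a b = if joins? F raised a b then δ else 0#

    private
      u : Fin n → Carrier
      u = unitDifference k t

      raisedWeight-away : ∀ {a b l} → Joins F raised a b → l ≢ b → raisedWeight a l ≡ 0#
      raisedWeight-away j l≢b = if-false (λ T → l≢b (Joins-unique {e = raised} j (joins?⇒Joins {e = raised} T)))

      raisedWeight-along : ∀ {a b} → Joins F raised a b → raisedWeight a b ≡ δ
      raisedWeight-along j = if-true (Joins⇒joins? {e = raised} j)

      laplacian-at-endpoint : ∀ x {a b} → Joins F raised a b → laplacian raisedWeight x a ≈ δ * (x a - x b)
      laplacian-at-endpoint x {a} {b} j = begin
        laplacian raisedWeight x a
          ≈⟨ sum-single _ b (λ l l≢b → trans (*-congʳ (reflexive (raisedWeight-away j l≢b))) (zeroˡ _)) ⟩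
        raisedWeight a b * (x a - x b)
          ≡⟨ ≡.cong (_* (x a - x b)) (raisedWeight-along j) ⟩
        δ * (x a - x b) ∎

    laplacian-raised : ∀ x v → laplacian raisedWeight x v ≈ δ * (unitDifference k t v * (x k - x t))
    laplacian-raised x v with v ≟ k | v ≟ t
    ... | yes ≡.refl | _ = begin
      laplacian raisedWeight x v
        ≈⟨ laplacian-at-endpoint x joins ⟩
      δ * (x v - x t)
        ≈⟨ at-k δ (x v - x t) ⟩
      δ * ((1# - 0#) * (x v - x t))
        ≈⟨ *-congˡ (*-congʳ (+-cong (identity-diag v) (-‿cong (identity-off (k≢t ∘ ≡.sym))))) ⟨
      δ * (u v * (x v - x t)) ∎
      where
      at-k : ∀ d y → d * y ≈ d * ((1# - 0#) * y)
      at-k = solve 2 (λ d y → d :* y := d :* ((con (+ 1) :- con (+ 0)) :* y)) refl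
    ... | no _ | yes ≡.refl = begin
      laplacian raisedWeight x v
        ≈⟨ laplacian-at-endpoint x (Joins-sym {e = raised} joins) ⟩
      δ * (x v - x k)
        ≈⟨ at-t δ (x k) (x v) ⟩
      δ * ((0# - 1#) * (x k - x v))
        ≈⟨ *-congˡ (*-congʳ (+-cong (identity-off k≢t) (-‿cong (identity-diag v)))) ⟨
      δ * (u v * (x k - x v)) ∎
      where
      at-t : ∀ d a b → d * (b - a) ≈ d * ((0# - 1#) * (a - b))
      at-t = solve 3 (λ d a b → d :* (b :- a) := d :* ((con (+ 0) :- con (+ 1)) :* (a :- b))) refl
    ... | no v≢k | no v≢t = begin
      laplacian raisedWeight x v
        ≈⟨ sum-zero (λ l → trans (*-congʳ (reflexive (if-false (off-edge l)))) (zeroˡ _)) ⟩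
      0#
        ≈⟨ elsewhere δ (x k - x t) ⟩
      δ * ((0# - 0#) * (x k - x t))
        ≈⟨ *-congˡ (*-congʳ (+-cong (identity-off (v≢k ∘ ≡.sym)) (-‿cong (identity-off (v≢t ∘ ≡.sym))))) ⟨
      δ * (u v * (x k - x t)) ∎
      where
      off-edge : ∀ l → ¬ T (joins? F raised v l)
      off-edge l T with Joins-endpoint {e = raised} joins (joins?⇒Joins {e = raised} T)
      ... | inj₁ v≡k = v≢k v≡k
      ... | inj₂ v≡t = v≢t v≡t
      elsewhere : ∀ d y → 0# ≈ d * ((0# - 0#) * y)
      elsewhere = solve 2 (λ d y → con (+ 0) := d :* ((con (+ 0) :- con (+ 0)) :* y)) refl

    IplusL-increase : ∀ v l → IplusL F G′ v l ≈ IplusL F G v l + δ * (unitDifference k t v * unitDifference k t l)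
    IplusL-increase v l = begin
      IplusL F G′ v l
        ≈⟨ ⊗-identityʳ (IplusL F G′) v l ⟨
      sumFin F (λ m → IplusL F G′ v m * eₗ m)
        ≈⟨ IplusL-apply G′ eₗ v ⟩
      eₗ v + laplacian (weightBetween F G′) eₗ v
        ≈⟨ +-congˡ (sum-cong-≋ (λ m → *-congʳ (weightBetween-increase v m))) ⟩
      eₗ v + laplacian (λ a b → weightBetween F G a b + raisedWeight a b) eₗ v
        ≈⟨ +-congˡ (laplacian-+ (weightBetween F G) raisedWeight eₗ v) ⟩
      eₗ v + (laplacian (weightBetween F G) eₗ v + laplacian raisedWeight eₗ v)
        ≈⟨ +-assoc _ _ _ ⟨
      (eₗ v + laplacian (weightBetween F G) eₗ v) + laplacian raisedWeight eₗ v
        ≈⟨ +-cong (sym (IplusL-apply G eₗ v)) (laplacian-raised eₗ v) ⟩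
      sumFin F (λ m → IplusL F G v m * eₗ m) + δ * (u v * u l)
        ≈⟨ +-congʳ (⊗-identityʳ (IplusL F G) v l) ⟩
      IplusL F G v l + δ * (u v * u l) ∎
      where
      eₗ : Fin n → Carrier
      eₗ m = identity F m l

module RaisedEdge {c ℓ₁ ℓ₂} (F : OrderedField c ℓ₁ ℓ₂)
                  {n} {G G′ : Multigraph F n} {Q Q′ : Matrix F n}
                  (Q-inverse : IsInverseOf F Q (IplusL F G)) (Q′-inverse : IsInverseOf F Q′ (IplusL F G′))
                  {k t : Fin n} (k≢t : k ≢ t) (increase : EdgeIncrease.WeightIncrease F k t G G′) where
  open OrderedField F hiding (zero)
  open OrderedFieldProperties F
  open IntegerRingSolver commutativeRing using (solve; _:=_; _:+_; _:-_; _:*_; :-_; con)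
  open Summation F
  open MatrixProperties F using (unitDifference; sum-*-unitDifference; identity-comm; module RankOneUpdate)
  open Laplacian F using (IplusL-comm)
  open Walks F using (separated-self)
  open MaximumPrinciple F
  open EdgeIncrease F
  open import Algebra.Properties.Ring ring using (-‿distribˡ-*; [y-z]x≈yx-zx)
  open ≤-Reasoning
  private module O = IsStrictTotalOrder isStrictTotalOrder

  open WeightIncrease increase

  column : ∀ j → IsResolventColumn G j (λ l → Q l j)
  column j v = proj₁ Q-inverse v j

  row : ∀ i → IsResolventColumn G i (Q i)
  row i v = begin-equality
    sumFin F (λ l → IplusL F G v l * Q i l)
      ≈⟨ sumFin≈sum (λ l → IplusL F G v l * Q i l) ⟩
    sum (λ l → IplusL F G v l * Q i l)
      ≈⟨ sum-cong-≋ (λ l → trans (*-comm _ _) (*-congˡ (reflexive (IplusL-comm G v l)))) ⟩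
    sum (λ l → Q i l * IplusL F G l v)
      ≈⟨ sumFin≈sum (λ l → Q i l * IplusL F G l v) ⟨
    sumFin F (λ l → Q i l * IplusL F G l v)
      ≈⟨ proj₂ Q-inverse i v ⟩
    identity F i v
      ≡⟨ identity-comm i v ⟩
    identity F v i ∎

  -- With u = e_k − e_t: α = Q u, β = uᵀ Q′ and γ = uᵀ Q.
  α : Fin n → Carrier
  α i = Q i k - Q i t

  β : Fin n → Carrier
  β j = Q′ k j - Q′ t j

  γ : Fin n → Carrier
  γ j = Q k j - Q t j

  update : ∀ i j → Q i j ≈ Q′ i j + δ * (α i * β j)
  update i j = trans (sherman-morrison i j) (+-congˡ (*-congˡ (*-cong (sum-*-unitDifference (Q i) k t) uQ′≈β)))
    where
    open RankOneUpdate δ (unitDifference k t) (IplusL-increase k≢t increase) (proj₂ Q-inverse) (proj₁ Q′-inverse)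
    uQ′≈β : uQ′ j ≈ β j
    uQ′≈β = trans (sum-cong-≋ (λ l → *-comm (unitDifference k t l) (Q′ l j))) (sum-*-unitDifference (λ l → Q′ l j) k t)

  private
    α-pos : ∀ i → Separated F G k t i → 0# < α i
    α-pos i sep = x<y⇒0<y-x (ResolventColumn.separated⇒decreasing {G = G} (row i) k≢t sep)

    γ-pos : ∀ j → Separated F G k t j → 0# < γ j
    γ-pos j sep = x<y⇒0<y-x (ResolventColumn.separated⇒decreasing {G = G} (column j) k≢t sep)

    γt<0 : γ t < 0#
    γt<0 = x<y⇒x-y<0 (ResolventColumn.separated⇒decreasing {G = G} (column t) (k≢t ∘ ≡.sym) (separated-self t k))

    scale : Carrier
    scale = 1# + δ * (γ k - γ t)

    γk-γt-pos : 0# < γ k - γ t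
    γk-γt-pos = x<y⇒0<y-x (O.trans γt<0 (γ-pos k (separated-self k t)))

    scale-pos : 0# < scale
    scale-pos = ≤-<-trans (inj₂ (sym (+-identityʳ 0#))) (+-mono-<-≤ 0<1 (<⇒≤ (*-pos δ>0 γk-γt-pos)))

    γ≈β*scale : ∀ j → γ j ≈ β j * scale
    γ≈β*scale j = trans (+-cong (update k j) (-‿cong (update t j))) (regroup _ _ _ (Q k k) (Q k t) (Q t k) (Q t t))
      where
      regroup : ∀ a b d qkk qkt qtk qtt →
        (a + d * ((qkk - qkt) * (a - b))) - (b + d * ((qtk - qtt) * (a - b))) ≈ (a - b) * (1# + d * ((qkk - qtk) - (qkt - qtt)))
      regroup = solve 7 (λ a b d qkk qkt qtk qtt →
        (a :+ d :* ((qkk :- qkt) :* (a :- b))) :- (b :+ d :* ((qtk :- qtt) :* (a :- b)))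
          := (a :- b) :* (con (+ 1) :+ d :* ((qkk :- qtk) :- (qkt :- qtt)))) refl

    β-pos : ∀ j → Separated F G k t j → 0# < β j
    β-pos j sep = pos-*-cancelʳ scale-pos (O.<-respʳ-≈ (γ≈β*scale j) (γ-pos j sep))

    βt<0 : β t < 0#
    βt<0 = 0<-x⇒x<0 (pos-*-cancelʳ scale-pos (begin-strict
      0#               <⟨ x<0⇒0<-x γt<0 ⟩
      - γ t            ≈⟨ -‿cong (γ≈β*scale t) ⟩
      - (β t * scale)  ≈⟨ -‿distribˡ-* (β t) scale ⟩
      - β t * scale    ∎))

    βk-βt-pos : 0# < β k - β t
    βk-βt-pos = pos-*-cancelʳ scale-pos (begin-strict
      0#                             <⟨ γk-γt-pos ⟩
      γ k - γ t                      ≈⟨ +-cong (γ≈β*scale k) (-‿cong (γ≈β*scale t)) ⟩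
      β k * scale - β t * scale      ≈⟨ [y-z]x≈yx-zx scale (β k) (β t) ⟨
      (β k - β t) * scale            ∎)

    increment : ∀ i j → Q′ i j - Q i j ≈ - (δ * (α i * β j))
    increment i j = trans (+-congˡ (-‿cong (update i j))) (cancel (Q′ i j) _)
      where
      cancel : ∀ q d → q - (q + d) ≈ - d
      cancel = solve 2 (λ q d → q :- (q :+ d) := :- d) refl

  Qkt<Q′kt : Q k t < Q′ k t
  Qkt<Q′kt = 0<y-x⇒x<y (begin-strict
    0#                   <⟨ *-pos δ>0 (*-pos (α-pos k (separated-self k t)) (x<0⇒0<-x βt<0)) ⟩
    δ * (α k * - β t)    ≈⟨ negate δ (α k) (β t) ⟨
    - (δ * (α k * β t))  ≈⟨ increment k t ⟨
    Q′ k t - Q k t       ∎)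
    where
    negate : ∀ d a b → - (d * (a * b)) ≈ d * (a * - b)
    negate = solve 3 (λ d a b → :- (d :* (a :* b)) := d :* (a :* (:- b))) refl

  separated⇒ΔQik<ΔQit : ∀ i → Separated F G k t i → Q′ i k - Q i k < Q′ i t - Q i t
  separated⇒ΔQik<ΔQit i sep = 0<y-x⇒x<y (begin-strict
    0#                                              <⟨ *-pos δ>0 (*-pos (α-pos i sep) βk-βt-pos) ⟩
    δ * (α i * (β k - β t))                         ≈⟨ difference δ (α i) (β k) (β t) ⟨
    - (δ * (α i * β t)) - - (δ * (α i * β k))       ≈⟨ +-cong (increment i t) (-‿cong (increment i k)) ⟨
    (Q′ i t - Q i t) - (Q′ i k - Q i k)             ∎)
    where
    difference : ∀ d a bk bt → - (d * (a * bt)) - - (d * (a * bk)) ≈ d * (a * (bk - bt))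
    difference = solve 4 (λ d a bk bt → (:- (d :* (a :* bt))) :- (:- (d :* (a :* bk))) := d :* (a :* (bk :- bt))) refl

  separated⇒Q′<Q : ∀ i₁ i₂ → Separated F G k t i₁ → Separated F G k t i₂ → Q′ i₁ i₂ < Q i₁ i₂
  separated⇒Q′<Q i₁ i₂ sep₁ sep₂ = 0<y-x⇒x<y (begin-strict
    0#                                   <⟨ *-pos δ>0 (*-pos (α-pos i₁ sep₁) (β-pos i₂ sep₂)) ⟩
    δ * (α i₁ * β i₂)                    ≈⟨ cancel (Q′ i₁ i₂) _ ⟨
    (Q′ i₁ i₂ + δ * (α i₁ * β i₂)) - Q′ i₁ i₂  ≈⟨ +-congʳ (update i₁ i₂) ⟨
    Q i₁ i₂ - Q′ i₁ i₂                   ∎)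
    where
    cancel : ∀ q d → (q + d) - q ≈ d
    cancel = solve 2 (λ q d → (q :+ d) :- q := d) refl

  Qik≈Qit⇒Q′≈Q : ∀ i → Q i k ≈ Q i t → ∀ j → Q′ i j ≈ Q i j
  Qik≈Qit⇒Q′≈Q i Qik≈Qit j = sym (trans (update i j) (trans (+-congˡ vanishes) (+-identityʳ _)))
    where
    α≈0 : α i ≈ 0#
    α≈0 = trans (+-congʳ Qik≈Qit) (-‿inverseʳ _)
    vanishes : δ * (α i * β j) ≈ 0#
    vanishes = trans (*-congˡ (trans (*-congʳ α≈0) (zeroˡ _))) (zeroʳ δ)

proposition8 : ∀ {c ℓ₁ ℓ₂} (F : OrderedField c ℓ₁ ℓ₂) → let open OrderedField F in
    ∀ {n} (G G′ : Multigraph F n) (Q Q′ : Matrix F n) →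
    IsInverseOf F Q (IplusL F G) → IsInverseOf F Q′ (IplusL F G′) →
    (k t : Fin n) → k ≢ t → Perturbation F k t G G′ →
    (Q k t < Q′ k t)
    × (∀ i → Separated F G k t i → Q′ i k - Q i k < Q′ i t - Q i t)
    × (∀ i₁ i₂ → Separated F G k t i₁ → Separated F G k t i₂ → Q′ i₁ i₂ < Q i₁ i₂)
    × (∀ i → Q i k ≈ Q i t → ∀ j → Q′ i j ≈ Q i j)
proposition8 F G G′ Q Q′ Q-inverse Q′-inverse k t k≢t perturbation =
  Qkt<Q′kt , separated⇒ΔQik<ΔQit , separated⇒Q′<Q , Qik≈Qit⇒Q′≈Q
  where
  open RaisedEdge F Q-inverse Q′-inverse k≢t (EdgeIncrease.perturbation⇒weightIncrease F perturbation)
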